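{- Let $m$ be a positive integer and let $D$ be an $m$-automaton with output in a finite set $A$ containing $0$. Let $v$ be a vertex of $D$ from which there is a walk to a vertex whose label is not $0$. Then $v$ is not tied if and only if there is at most one walk of positive length from $v$ to $v$ that contains $v$ only as its first and last vertex.
   Context: An $m$-automaton with output in $A$ is a finite directed graph (multiple edges and loops allowed) such that: each vertex is labeled by an element of $A$; exactly one vertex is additionally labeled `Start'; each vertex has exactly $m$ outgoing edges, labeled by the distinct elements of $\{0,\dots,m-1\}$; an edge labeled $0$ joins two vertices with the same $A$-label; every vertex is reachable from `Start'. A walk is a sequence of edges, each starting where the previous one ends; its length is its number of edges. A vertex $v$ is tied if (1) there is a (possibly empty) walk from $v$ to a vertex with label different from $0$, and (2) there exist two different walks of the same length from $v$ to $v$. -}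

module Defs where

open import Data.Nat using (ℕ; zero; suc; _<_)
open import Data.Fin using (Fin; toℕ)
open import Data.List using (List; []; _∷_)
open import Data.List.Membership.Propositional using (_∈_)
open import Data.Product using (Σ; ∃; ∃-syntax; _×_; _,_)
open import Relation.Nullary using (¬_)
open import Relation.Binary.PropositionalEquality using (_≡_; _≢_)

-- Every vertex v has
-- exactly m outgoing edges, labelled by the distinct elements of Fin m; the
-- edge from v labelled i is the pair (v , i) and ends at δ v i (multiple edges
-- and loops are allowed since δ is an arbitrary function).
record Automaton (m : ℕ) (A : Set) : Set where
  field
    n      : ℕ
    label  : Fin n → A
    start  : Fin n
    δ      : Fin n → Fin m → Fin n

  data Walk : Fin n → Fin n → Set where
    nil  : ∀ {u} → Walk u u
    cons : ∀ {u w} (i : Fin m) → Walk (δ u i) w → Walk u w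

  length : ∀ {u w} → Walk u w → ℕ
  length nil        = 0
  length (cons i p) = suc (length (p))

  vertsExceptLast : ∀ {u w} → Walk u w → List (Fin n)
  vertsExceptLast nil                 = []
  vertsExceptLast (cons {u = u} i p) = u ∷ vertsExceptLast p

  interior : ∀ {u w} → Walk u w → List (Fin n)
  interior nil        = []
  interior (cons i p) = vertsExceptLast p

  Reachable : Fin n → Fin n → Set
  Reachable u w = Walk u w

record IsAutomaton {m : ℕ} {A : Set} (D : Automaton m A) : Set where
  open Automaton D
  field
    zero-edge : ∀ v (i : Fin m) → toℕ i ≡ 0 → label (δ v i) ≡ label v
    reachable : ∀ v → Reachable start v

module _ {m : ℕ} {A : Set} (0ᴬ : A) (D : Automaton m A) where
  open Automaton D

  ReachesNonzero : Fin n → Set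
  ReachesNonzero v = ∃[ w ] (Walk v w × label w ≢ 0ᴬ)

  Tied : Fin n → Set
  Tied v = ReachesNonzero v ×
           (∃[ p ] ∃[ q ] (length {v} {v} p ≡ length q × p ≢ q))

  FirstReturn : (v : Fin n) → Walk v v → Set
  FirstReturn v p = 0 < length p × ¬ (v ∈ interior p)

  AtMostOneFirstReturn : Fin n → Set
  AtMostOneFirstReturn v =
    ∀ (p q : Walk v v) → FirstReturn v p → FirstReturn v q → p ≡ q

{-# OPTIONS --safe #-}
module Submission where

-- A closed walk at v of positive length factors uniquely as a first return to v
-- followed by a closed walk at v: the first factor is cut at the first revisit
-- of v. So if v has at most one first return, induction on length shows that
-- closed walks at v of equal length coincide. Conversely, distinct first returns
-- p and q give the walks p q and q p, of equal length, which differ because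
-- their first returns differ. Neither direction uses the labels, 0 < m or the
-- automaton axioms.

open import Defs
open import Data.Nat using (ℕ; suc; pred; _<_; _≤_; _+_; s≤s; z≤n)
open import Data.Nat.Properties using (+-comm; +-cancelˡ-≡; m≤n+m; ≤-trans; ≤-reflexive; ≤-refl)
open import Data.Fin using (Fin; zero)
import Data.Fin.Properties as Fin
open import Data.Product using (_×_; _,_; ∃-syntax; Σ-syntax)
open import Data.List.Membership.Propositional using (_∈_)
open import Data.List.Relation.Unary.Any using (here; there)
open import Data.Empty using (⊥-elim)
open import Function using (_∘_)
open import Relation.Nullary using (¬_; yes; no)
open import Relation.Nullary.Decidable using (decidable-stable)
open import Relation.Binary.Definitions using (DecidableEquality)
open import Relation.Binary.PropositionalEquality
  using (_≡_; refl; sym; trans; cong; subst; module ≡-Reasoning)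

module Walks {m : ℕ} {A : Set} (D : Automaton m A) where
  open Automaton D

  infixr 5 _++_
  _++_ : ∀ {u w z} → Walk u w → Walk w z → Walk u z
  nil      ++ q = q
  cons i p ++ q = cons i (p ++ q)

  length-++ : ∀ {u w z} (p : Walk u w) (q : Walk w z) →
              length (p ++ q) ≡ length p + length q
  length-++ nil        q = refl
  length-++ (cons i p) q = cong suc (length-++ p q)

  length-++-comm : ∀ {u w} (p : Walk u w) (q : Walk w u) →
                   length (p ++ q) ≡ length (q ++ p)
  length-++-comm p q = begin
    length (p ++ q)     ≡⟨ length-++ p q ⟩
    length p + length q ≡⟨ +-comm (length p) (length q) ⟩
    length q + length p ≡⟨ sym (length-++ q p) ⟩
    length (q ++ p)     ∎
    where open ≡-Reasoning

  length-suffix-≤ : ∀ {u w z} (p : Walk u w) (q : Walk w z) → length q ≤ length (p ++ q)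
  length-suffix-≤ p q = ≤-trans (m≤n+m (length q) (length p)) (≤-reflexive (sym (length-++ p q)))

  length-++-cancelˡ : ∀ {u w z} (p : Walk u w) (q r : Walk w z) →
                      length (p ++ q) ≡ length (p ++ r) → length q ≡ length r
  length-++-cancelˡ p q r eq =
    +-cancelˡ-≡ (length p) (length q) (length r)
      (trans (sym (length-++ p q)) (trans eq (length-++ p r)))

  cons-injective : ∀ {u w i j} {p : Walk (δ u i) w} {q : Walk (δ u j) w} →
                   cons i p ≡ cons j q →
                   ∃[ i≡j ] subst (λ k → Walk (δ u k) w) i≡j p ≡ q
  cons-injective refl = refl , refl

  _≟_ : ∀ {u w} → DecidableEquality (Walk u w)
  nil      ≟ nil      = yes refl
  nil      ≟ cons j q = no λ ()
  cons i p ≟ nil      = no λ ()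
  cons i p ≟ cons j q with i Fin.≟ j
  ... | no i≢j = no λ { refl → i≢j refl }
  ... | yes refl with p ≟ q
  ...   | yes refl = yes refl
  ...   | no p≢q   = no λ { refl → p≢q refl }

  AvoidsBeforeEnd : ∀ {u w} → Fin n → Walk u w → Set
  AvoidsBeforeEnd v p = ¬ v ∈ vertsExceptLast p

  ++-avoiding-prefix-unique : ∀ {v x w} {p q : Walk x v} {r s : Walk v w} →
                              AvoidsBeforeEnd v p → AvoidsBeforeEnd v q →
                              p ++ r ≡ q ++ s → p ≡ q
  ++-avoiding-prefix-unique {p = nil}      {nil}      _  _  _ = refl
  ++-avoiding-prefix-unique {p = nil}      {cons j q} _  aq _ = ⊥-elim (aq (here refl))
  ++-avoiding-prefix-unique {p = cons i p} {nil}      ap _  _ = ⊥-elim (ap (here refl))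
  ++-avoiding-prefix-unique {p = cons i p} {cons j q} ap aq e with cons-injective e
  ... | refl , e′ = cong (cons i) (++-avoiding-prefix-unique (ap ∘ there) (aq ∘ there) e′)

  splitAtFirstVisit : ∀ {v x} (p : Walk x v) →
                      Σ[ a ∈ Walk x v ] Σ[ b ∈ Walk v v ] AvoidsBeforeEnd v a × p ≡ a ++ b
  splitAtFirstVisit nil = nil , nil , (λ ()) , refl
  splitAtFirstVisit {v} {x} (cons i p) with x Fin.≟ v
  ... | yes refl = nil , cons i p , (λ ()) , refl
  ... | no x≢v with a , b , a-avoids , p≡ab ← splitAtFirstVisit p =
    cons i a , b , ia-avoids , cong (cons i) p≡ab
    where
    ia-avoids : AvoidsBeforeEnd v (cons i a)
    ia-avoids (here v≡x)  = x≢v (sym v≡x)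
    ia-avoids (there v∈a) = a-avoids v∈a

module FirstReturns {m : ℕ} {A : Set} (0ᴬ : A) (D : Automaton m A) (v : Fin (Automaton.n D)) where
  open Automaton D
  open Walks D

  firstReturn-cons : ∀ {i} {p : Walk (δ v i) v} → AvoidsBeforeEnd v p → FirstReturn 0ᴬ D v (cons i p)
  firstReturn-cons p-avoids = s≤s z≤n , p-avoids

  firstReturn-++-comm⇒≡ : ∀ {p q : Walk v v} → FirstReturn 0ᴬ D v p → FirstReturn 0ᴬ D v q →
                          p ++ q ≡ q ++ p → p ≡ q
  firstReturn-++-comm⇒≡ {cons i p} {cons j q} (_ , p-avoids) (_ , q-avoids) e with cons-injective e
  ... | refl , e′ = cong (cons i) (++-avoiding-prefix-unique p-avoids q-avoids e′)

  closedWalk-≡-by-length : AtMostOneFirstReturn 0ᴬ D v →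
                           (p q : Walk v v) → length p ≡ length q → p ≡ q
  closedWalk-≡-by-length unique p q = bounded (length p) p q ≤-refl
    where
    bounded : ∀ k (p q : Walk v v) → length p ≤ k → length p ≡ length q → p ≡ q
    bounded _ nil nil _ _ = refl
    bounded (suc k) (cons i p) (cons j q) (s≤s |p|≤k) |p|≡|q|
      with a , b , a-avoids , p≡ab ← splitAtFirstVisit p
         | c , d , c-avoids , q≡cd ← splitAtFirstVisit q
      with refl ← unique (cons i a) (cons j c) (firstReturn-cons a-avoids) (firstReturn-cons c-avoids)
      = begin
        cons i p        ≡⟨ cong (cons i) p≡ab ⟩
        cons i (a ++ b) ≡⟨ cong (cons i ∘ (a ++_)) (bounded k b d |b|≤k |b|≡|d|) ⟩
        cons i (a ++ d) ≡⟨ cong (cons i) q≡cd ⟨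
        cons i q        ∎
      where
      open ≡-Reasoning
      |b|≤k : length b ≤ k
      |b|≤k = ≤-trans (length-suffix-≤ a b) (subst (_≤ k) (cong length p≡ab) |p|≤k)
      |b|≡|d| : length b ≡ length d
      |b|≡|d| = length-++-cancelˡ a b d (begin
        length (a ++ b) ≡⟨ cong length p≡ab ⟨
        length p        ≡⟨ cong pred |p|≡|q| ⟩
        length q        ≡⟨ cong length q≡cd ⟩
        length (a ++ d) ∎)

mainTheorem2 : (m : ℕ) → 0 < m → (a : ℕ) → (D : Automaton m (Fin (suc a))) →
    IsAutomaton D → (v : Fin (Automaton.n D)) → ReachesNonzero zero D v →
    ((¬ Tied zero D v → AtMostOneFirstReturn zero D v) ×
    (AtMostOneFirstReturn zero D v → ¬ Tied zero D v))
mainTheorem2 m _ a D _ v reaches = notTied⇒unique , unique⇒notTied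
  where
  open Walks D
  open FirstReturns zero D v

  notTied⇒unique : ¬ Tied zero D v → AtMostOneFirstReturn zero D v
  notTied⇒unique notTied p q p-first q-first = decidable-stable (p ≟ q) λ p≢q →
    notTied (reaches , p ++ q , q ++ p , length-++-comm p q ,
             p≢q ∘ firstReturn-++-comm⇒≡ p-first q-first)

  unique⇒notTied : AtMostOneFirstReturn zero D v → ¬ Tied zero D v
  unique⇒notTied unique (_ , p , q , |p|≡|q| , p≢q) = p≢q (closedWalk-≡-by-length unique p q |p|≡|q|)
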